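{- Let $\alpha\in(0,1)$ be irrational, $\alpha=[0;a_1,a_2,\dots]$, and let $n\ge1$ with $a_n\ge2$ and $a_{n+1}=1$. Then $q_n-q_{n-1}$ and $2q_{n-1}+q_n$ are two successive elements of the sequence $\mathfrak{Q}$.
   Context: $p_n/q_n=[0;a_1,\dots,a_n]$ ($n\ge0$, lowest terms, $q_n>0$) are the convergents of $\alpha$, with $q_{ -1}=0$, $q_0=1$, $q_n=a_nq_{n-1}+q_{n-2}$. For $t\ge1$, $\psi^{[2]}_\alpha(t)=\min\{|q\alpha-p|: p,q\in\mathbb{Z},\ 1\le q\le t,\ (p,q)\ne(p_n,q_n)\ \forall n\ge0\}$; this function is piecewise constant with integer points of discontinuity. $\mathfrak{Q}:\ 1=\mathfrak{q}_1<\mathfrak{q}_2<\dots$ is the increasing sequence consisting of $1$ and all points of discontinuity of $\psi^{[2]}_\alpha$. -}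

module Defs where

open import Data.Nat as ℕ using (ℕ; zero; suc)
open import Data.Integer as ℤ using (ℤ; +_; -_)
open import Data.Product using (_×_; _,_; proj₁; proj₂; ∃-syntax)
open import Data.Sum using (_⊎_)
open import Data.Empty using (⊥)
open import Relation.Nullary using (¬_)
open import Relation.Binary.PropositionalEquality using (_≡_)

-- An irrational α ∈ (0,1) is encoded by its (infinite, unique) continued
-- fraction expansion α = [0; a 1, a 2, ...] with a i ≥ 1 for i ≥ 1.
-- (The value a 0 is ignored: a₀ = 0 is built in below.)
PartialQuotients : (ℕ → ℕ) → Set
PartialQuotients a = ∀ i → 1 ℕ.≤ a (suc i)

-- qPair a n = (q_{n-1}, q_n),  with q_{-1} = 0, q_0 = 1
qPair : (ℕ → ℕ) → ℕ → ℕ × ℕ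
qPair a zero = 0 , 1
qPair a (suc n) = proj₂ (qPair a n) , a (suc n) ℕ.* proj₂ (qPair a n) ℕ.+ proj₁ (qPair a n)

-- pPair a n = (p_{n-1}, p_n),  with p_{-1} = 1, p_0 = a₀ = 0
pPair : (ℕ → ℕ) → ℕ → ℕ × ℕ
pPair a zero = 1 , 0
pPair a (suc n) = proj₂ (pPair a n) , a (suc n) ℕ.* proj₂ (pPair a n) ℕ.+ proj₁ (pPair a n)

qc : (ℕ → ℕ) → ℕ → ℕ
qc a n = proj₂ (qPair a n)

pc : (ℕ → ℕ) → ℕ → ℕ
pc a n = proj₂ (pPair a n)

-- "r α − s > 0" for integers r, s.  Since α lies strictly between
-- consecutive convergents p_k/q_k and p_{k+1}/q_{k+1}, which converge to α,
-- r α − s > 0 holds iff for some k both r p_k − s q_k > 0 and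
-- r p_{k+1} − s q_{k+1} > 0.
PosForm : (ℕ → ℕ) → ℤ → ℤ → Set
PosForm a r s = ∃[ k ] ((+ 0 ℤ.< r ℤ.* + pc a k ℤ.- s ℤ.* + qc a k)
                      × (+ 0 ℤ.< r ℤ.* + pc a (suc k) ℤ.- s ℤ.* + qc a (suc k)))

NegForm : (ℕ → ℕ) → ℤ → ℤ → Set
NegForm a r s = PosForm a (- r) (- s)

-- |q α − p| < |q' α − p'|.
-- With A = qα − p, B = q'α − p':  |A| < |B|  ⇔  (B − A)(B + A) > 0.
AbsLt : (ℕ → ℕ) → ℕ → ℤ → ℕ → ℤ → Set
AbsLt a q p q' p' =
  (PosForm a (+ q' ℤ.- + q) (p' ℤ.- p) × PosForm a (+ q' ℤ.+ + q) (p' ℤ.+ p))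
  ⊎ (NegForm a (+ q' ℤ.- + q) (p' ℤ.- p) × NegForm a (+ q' ℤ.+ + q) (p' ℤ.+ p))

IsConvergent : (ℕ → ℕ) → ℤ → ℕ → Set
IsConvergent a p q = ∃[ n ] ((p ≡ + pc a n) × (q ≡ qc a n))

-- pairs allowed in the minimum defining ψ^[2]
Admissible : (ℕ → ℕ) → ℤ → ℕ → Set
Admissible a p q = (1 ℕ.≤ q) × ¬ IsConvergent a p q

-- t ≥ 2 is a point of discontinuity of ψ^[2]_α, i.e. ψ^[2](t) < ψ^[2](t−1):
-- some admissible pair with denominator t beats every admissible pair with
-- denominator in [1, t−1]  (ψ^[2] is nonincreasing and the minima are attained).
Discontinuity : (ℕ → ℕ) → ℕ → Set
Discontinuity a t =
  (2 ℕ.≤ t) ×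
  (∃[ p ] (Admissible a p t ×
     (∀ p' q' → Admissible a p' q' → q' ℕ.< t → AbsLt a t p q' p')))

InQ : (ℕ → ℕ) → ℕ → Set
InQ a t = (t ≡ 1) ⊎ Discontinuity a t

SuccessiveInQ : (ℕ → ℕ) → ℕ → ℕ → Set
SuccessiveInQ a x y =
  (x ℕ.< y) × InQ a x × InQ a y ×
  (∀ z → InQ a z → x ℕ.< z → z ℕ.< y → ⊥)

-- Write integer pairs in the basis of consecutive convergents c_k = (p_k, q_k):
-- (p, q) = u c_n + (u − w) c_{n+1}.  Then q α − p = (q_n α − p_n)((1 − θ) u + θ w) for a
-- fixed θ ∈ (0, 1), so |q α − p| < |q′ α − p′| as soon as the coordinates (u′, w′) dominate
-- (u, w) in the sense of Dominates.  As a_{n+1} = 1, the pair with denominator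
-- x = q_n − q_{n−1} is 2 c_n − c_{n+1}, with coordinates (2, 3), and the pair with
-- denominator y = 2 q_{n−1} + q_n is 2 c_{n+1} − c_n, with coordinates (−1, −3); as a_n ≥ 2,
-- every other non-convergent pair with denominator in [1, y) has coordinates of one sign and
-- of size at least (2, 4).  So the x-pair and the y-pair each beat every admissible pair of
-- smaller denominator, and no denominator strictly between x and y is a discontinuity: its
-- best pair would have to beat the x-pair, which beats it.
module Submission where

open import Defs
import Data.Nat as ℕ
import Data.Nat.Properties as ℕₚ
import Data.Integer as ℤ
import Data.Integer.Properties as ℤₚ
open import Data.Product using (Σ-syntax; _×_; _,_; proj₁; proj₂)
open import Data.Sum using (_⊎_; inj₁; inj₂)
open import Data.Empty using (⊥; ⊥-elim)
open import Function using (_∘_)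
open import Relation.Binary.PropositionalEquality
  using (_≡_; _≢_; refl; sym; trans; cong; cong₂; subst; subst₂; module ≡-Reasoning)

module Quadrants where
  open ℕ using (ℕ; zero; suc; z≤n; s≤s)
  open ℤ using (ℤ; +_; -_; _+_; _-_; _≤_; _<_; +≤+; +<+)

  nonNeg-cases : ∀ {u} → + 0 ≤ u → + 0 < u ⊎ u ≡ + 0
  nonNeg-cases (+≤+ {n = zero} _)  = inj₂ refl
  nonNeg-cases (+≤+ {n = suc _} _) = inj₁ (+<+ (s≤s z≤n))

  -- (1 − θ) u + θ w > 0 for every 0 < θ < 1.
  Quadrant : ℤ → ℤ → Set
  Quadrant u w = + 0 ≤ u × + 0 ≤ w × (+ 0 < u ⊎ + 0 < w)

  -- With v and v′ the interpolations of (u, w) and (u′, w′), both v′ − v and v′ + v have one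
  -- strict sign on 0 < θ < 1, hence |v| < |v′| there.
  Dominates : ℤ → ℤ → ℤ → ℤ → Set
  Dominates u′ w′ u w =
    (Quadrant (u′ - u) (w′ - w) × Quadrant (u′ + u) (w′ + w)) ⊎
    (Quadrant (- (u′ - u)) (- (w′ - w)) × Quadrant (- (u′ + u)) (- (w′ + w)))

  data Far : ℤ → ℤ → Set where
    far⁺ : ∀ i j → Far (+ (2 ℕ.+ i)) (+ (4 ℕ.+ j))
    far⁻ : ∀ i j → Far (- + (2 ℕ.+ i)) (- + (4 ℕ.+ j))

  quadrant-+ : ∀ {m n} → Quadrant (+ m) (+ suc n)
  quadrant-+ = +≤+ z≤n , +≤+ z≤n , inj₂ (+<+ (s≤s z≤n))

  -- The split on i lets the sum − (2 + i) + 2 normalise.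
  far-dominates-x : ∀ {u w} → Far u w → Dominates u w (+ 2) (+ 3)
  far-dominates-x (far⁺ i j)       = inj₁ (quadrant-+ , quadrant-+)
  far-dominates-x (far⁻ zero j)    = inj₂ (quadrant-+ , quadrant-+)
  far-dominates-x (far⁻ (suc i) j) = inj₂ (quadrant-+ , quadrant-+)

  far-dominates-y : ∀ {u w} → Far u w → Dominates u w (- + 1) (- + 3)
  far-dominates-y (far⁺ i j) = inj₁ (quadrant-+ , quadrant-+)
  far-dominates-y (far⁻ i j) = inj₂ (quadrant-+ , quadrant-+)

  x-dominates-y : Dominates (+ 2) (+ 3) (- + 1) (- + 3)
  x-dominates-y = inj₁ (quadrant-+ , (+≤+ z≤n , +≤+ z≤n , inj₁ (+<+ (s≤s z≤n))))

module LinearForms (a : ℕ.ℕ → ℕ.ℕ) (pq : PartialQuotients a) where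
  open ℕ using (ℕ; zero; suc)
  open ℤ using (ℤ; +_; -_; _+_; _*_; _-_; _≤_; _<_; +≤+)
  open import Data.Integer.Tactic.RingSolver using (solve-∀)
  open Quadrants
  open ≡-Reasoning

  P Q : ℕ → ℤ
  P k = + pc a k
  Q k = + qc a k

  L : ℤ → ℤ → ℕ → ℤ
  L r s k = r * P k - s * Q k

  P-rec : ∀ k → P (suc (suc k)) ≡ + a (suc (suc k)) * P (suc k) + P k
  P-rec k = trans (ℤₚ.pos-+ _ (pc a k)) (cong (_+ P k) (ℤₚ.pos-* (a (suc (suc k))) _))

  Q-rec : ∀ k → Q (suc (suc k)) ≡ + a (suc (suc k)) * Q (suc k) + Q k
  Q-rec k = trans (ℤₚ.pos-+ _ (qc a k)) (cong (_+ Q k) (ℤₚ.pos-* (a (suc (suc k))) _))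

  L-rec : ∀ r s k → L r s (suc (suc k)) ≡ + a (suc (suc k)) * L r s (suc k) + L r s k
  L-rec r s k = trans (cong₂ (λ p q → r * p - s * q) (P-rec k) (Q-rec k))
                      (linear r s (+ a (suc (suc k))) (P (suc k)) (P k) (Q (suc k)) (Q k))
    where
    linear : ∀ r s c p₁ p₀ q₁ q₀ →
             r * (c * p₁ + p₀) - s * (c * q₁ + q₀) ≡ c * (r * p₁ - s * q₁) + (r * p₀ - s * q₀)
    linear = solve-∀

  L-neg : ∀ r s k → L (- r) (- s) k ≡ - L r s k
  L-neg r s k = negation r s (P k) (Q k)
    where
    negation : ∀ r s p q → (- r) * p - (- s) * q ≡ - (r * p - s * q)
    negation = solve-∀

  L-rec-≥ : ∀ r s k → + 0 ≤ L r s (suc k) → L r s (suc k) + L r s k ≤ L r s (suc (suc k))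
  L-rec-≥ r s k 0≤L₁ =
    subst (L r s (suc k) + L r s k ≤_) (sym (L-rec r s k))
          (ℤₚ.+-monoˡ-≤ (L r s k) (≤-scaled (pq (suc k)) 0≤L₁))
    where
    ≤-scaled : ∀ {c x} → 1 ℕ.≤ c → + 0 ≤ x → x ≤ + c * x
    ≤-scaled {c} {+ n} 1≤c _ =
      subst (+ n ≤_) (ℤₚ.pos-* c n) (+≤+ (ℕₚ.m≤n*m n c {{ℕ.>-nonZero 1≤c}}))

  L-pos-persists : ∀ r s k → + 0 < L r s k → + 0 < L r s (suc k) →
                 ∀ j → + 0 < L r s (j ℕ.+ k) × + 0 < L r s (suc (j ℕ.+ k))
  L-pos-persists r s k L₀>0 L₁>0 zero = L₀>0 , L₁>0
  L-pos-persists r s k L₀>0 L₁>0 (suc j) with L-pos-persists r s k L₀>0 L₁>0 j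
  ... | Lⱼ>0 , Lⱼ₊₁>0 =
    Lⱼ₊₁>0 , ℤₚ.<-≤-trans (ℤₚ.+-mono-< Lⱼ₊₁>0 Lⱼ>0) (L-rec-≥ r s (j ℕ.+ k) (ℤₚ.<⇒≤ Lⱼ₊₁>0))

  posForm-negForm-disjoint : ∀ {r s} → PosForm a r s → NegForm a r s → ⊥
  posForm-negForm-disjoint {r} {s} (k , h₀ , h₁) (j , g₀ , g₁) =
    ℤₚ.<-asym (proj₁ (L-pos-persists r s k h₀ h₁ j)) L<0
    where
    L⁻>0 : + 0 < L (- r) (- s) (j ℕ.+ k)
    L⁻>0 = subst (λ i → + 0 < L (- r) (- s) i) (ℕₚ.+-comm k j) (proj₁ (L-pos-persists (- r) (- s) j g₀ g₁ k))
    L<0 : L r s (j ℕ.+ k) < + 0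
    L<0 = ℤₚ.neg-cancel-< (subst (+ 0 <_) (L-neg r s (j ℕ.+ k)) L⁻>0)

  posForm-of-pos-nonNeg : ∀ r s k → + 0 < L r s k → + 0 ≤ L r s (suc k) → PosForm a r s
  posForm-of-pos-nonNeg r s k L₀>0 L₁≥0 with nonNeg-cases L₁≥0
  ... | inj₁ L₁>0 = k , L₀>0 , L₁>0
  ... | inj₂ L₁≡0 = suc (suc k) , L₂>0 , ℤₚ.<-≤-trans L₂>0′ (L-rec-≥ r s (suc k) (ℤₚ.<⇒≤ L₂>0))
    where
    L₂≡L₀ : L r s (suc (suc k)) ≡ L r s k
    L₂≡L₀ = begin
      L r s (suc (suc k))                       ≡⟨ L-rec r s k ⟩
      + a (suc (suc k)) * L r s (suc k) + L r s k ≡⟨ cong (λ t → + a (suc (suc k)) * t + L r s k) L₁≡0 ⟩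
      + a (suc (suc k)) * + 0 + L r s k         ≡⟨ cong (_+ L r s k) (ℤₚ.*-zeroʳ (+ a (suc (suc k)))) ⟩
      + 0 + L r s k                             ≡⟨ ℤₚ.+-identityˡ (L r s k) ⟩
      L r s k                                   ∎
    L₂>0 : + 0 < L r s (suc (suc k))
    L₂>0 = subst (+ 0 <_) (sym L₂≡L₀) L₀>0
    L₂>0′ : + 0 < L r s (suc (suc k)) + L r s (suc k)
    L₂>0′ = subst (+ 0 <_) (sym (trans (cong (λ t → L r s (suc (suc k)) + t) L₁≡0) (ℤₚ.+-identityʳ _))) L₂>0

  -- The two arguments of Quadrant are positive multiples of the values of r x − s at p_{k+1}/q_{k+1}
  -- and at the mediant (p_k + p_{k+1})/(q_k + q_{k+1}), which enclose α.
  posForm-of-quadrant : ∀ r s k → Quadrant (L r s (suc k)) (L r s (suc k) + L r s k) → PosForm a r s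
  posForm-of-quadrant r s k (L₁≥0 , w≥0 , strict) with nonNeg-cases L₁≥0 | strict
  ... | inj₁ L₁>0 | _        = posForm-of-pos-nonNeg r s (suc k) L₁>0 (ℤₚ.≤-trans w≥0 (L-rec-≥ r s k L₁≥0))
  ... | inj₂ L₁≡0 | inj₁ L₁>0 = ⊥-elim (ℤₚ.<-irrefl (sym L₁≡0) L₁>0)
  ... | inj₂ L₁≡0 | inj₂ w>0  = posForm-of-pos-nonNeg r s k (subst (+ 0 <_) w≡L₀ w>0) L₁≥0
    where
    w≡L₀ : L r s (suc k) + L r s k ≡ L r s k
    w≡L₀ = trans (cong (_+ L r s k) L₁≡0) (ℤₚ.+-identityˡ (L r s k))

  E : ℕ → ℤ
  E k = Q k * P (suc k) - P k * Q (suc k)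

  E-flips : ∀ k → E (suc k) ≡ - E k
  E-flips k = trans (cong₂ (λ p q → Q (suc k) * p - P (suc k) * q) (P-rec k) (Q-rec k))
                    (expand (+ a (suc (suc k))) (P (suc k)) (P k) (Q (suc k)) (Q k))
    where
    expand : ∀ c p₁ p₀ q₁ q₀ → q₁ * (c * p₁ + p₀) - p₁ * (c * q₁ + q₀) ≡ - (q₀ * p₁ - p₀ * q₁)
    expand = solve-∀

  E-unit : ∀ k → E k ≡ + 1 ⊎ E k ≡ - + 1
  E-unit zero = inj₁ (trans (simplify (P 1) (Q 1)) (cong (λ t → + (t ℕ.+ 1)) (ℕₚ.*-zeroʳ (a 1))))
    where
    simplify : ∀ p₁ q₁ → + 1 * p₁ - + 0 * q₁ ≡ p₁
    simplify = solve-∀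
  E-unit (suc k) with E-unit k
  ... | inj₁ E≡1  = inj₂ (trans (E-flips k) (cong -_ E≡1))
  ... | inj₂ E≡-1 = inj₁ (trans (E-flips k) (cong -_ E≡-1))

  E-square : ∀ k → E k * E k ≡ + 1
  E-square k with E-unit k
  ... | inj₁ E≡1  = cong (λ e → e * e) E≡1
  ... | inj₂ E≡-1 = cong (λ e → e * e) E≡-1

  record Coords (k : ℕ) (r s u w : ℤ) : Set where
    constructor _,_
    field
      r≡ : r ≡ u * Q k + (u - w) * Q (suc k)
      s≡ : s ≡ u * P k + (u - w) * P (suc k)

  L-of-coords : ∀ {k r s u w} → Coords k r s u w →
                L r s (suc k) ≡ E k * u × L r s (suc k) + L r s k ≡ E k * w
  L-of-coords {k} {u = u} {w} (r≡ , s≡) =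
    trans (cong₂ (λ r s → L r s (suc k)) r≡ s≡) (at-next u w (P k) (P (suc k)) (Q k) (Q (suc k))) ,
    trans (cong₂ (λ r s → L r s (suc k) + L r s k) r≡ s≡) (at-mediant u w (P k) (P (suc k)) (Q k) (Q (suc k)))
    where
    at-next : ∀ u w p₀ p₁ q₀ q₁ →
              (u * q₀ + (u - w) * q₁) * p₁ - (u * p₀ + (u - w) * p₁) * q₁ ≡ (q₀ * p₁ - p₀ * q₁) * u
    at-next = solve-∀
    at-mediant : ∀ u w p₀ p₁ q₀ q₁ →
                 ((u * q₀ + (u - w) * q₁) * p₁ - (u * p₀ + (u - w) * p₁) * q₁) +
                 ((u * q₀ + (u - w) * q₁) * p₀ - (u * p₀ + (u - w) * p₁) * q₀) ≡ (q₀ * p₁ - p₀ * q₁) * w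
    at-mediant = solve-∀

  coords-exist : ∀ k r s → Σ[ u ∈ ℤ ] Σ[ w ∈ ℤ ] Coords k r s u w
  coords-exist k r s = E k * L r s (suc k) , E k * (L r s (suc k) + L r s k) ,
    sym (trans (invert r s (P k) (P (suc k)) (Q k) (Q (suc k))) (unit r)) ,
    sym (trans (invert′ r s (P k) (P (suc k)) (Q k) (Q (suc k))) (unit s))
    where
    unit : ∀ t → (E k * E k) * t ≡ t
    unit t = trans (cong (_* t) (E-square k)) (ℤₚ.*-identityˡ t)
    invert : ∀ r s p₀ p₁ q₀ q₁ →
             let e = q₀ * p₁ - p₀ * q₁ ; l₀ = r * p₀ - s * q₀ ; l₁ = r * p₁ - s * q₁
             in  (e * l₁) * q₀ + (e * l₁ - e * (l₁ + l₀)) * q₁ ≡ (e * e) * r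
    invert = solve-∀
    invert′ : ∀ r s p₀ p₁ q₀ q₁ →
              let e = q₀ * p₁ - p₀ * q₁ ; l₀ = r * p₀ - s * q₀ ; l₁ = r * p₁ - s * q₁
              in  (e * l₁) * p₀ + (e * l₁ - e * (l₁ + l₀)) * p₁ ≡ (e * e) * s
    invert′ = solve-∀

  coords-neg : ∀ {k r s u w} → Coords k r s u w → Coords k (- r) (- s) (- u) (- w)
  coords-neg {u = u} {w} (r≡ , s≡) =
    trans (cong -_ r≡) (negate u w _ _) , trans (cong -_ s≡) (negate u w _ _)
    where
    negate : ∀ u w x y → - (u * x + (u - w) * y) ≡ (- u) * x + ((- u) - (- w)) * y
    negate = solve-∀

  coords-− : ∀ {k r s u w r′ s′ u′ w′} → Coords k r s u w → Coords k r′ s′ u′ w′ →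
             Coords k (r′ - r) (s′ - s) (u′ - u) (w′ - w)
  coords-− {u = u} {w} {u′ = u′} {w′} (r≡ , s≡) (r′≡ , s′≡) =
    trans (cong₂ _-_ r′≡ r≡) (subtract u w u′ w′ _ _) , trans (cong₂ _-_ s′≡ s≡) (subtract u w u′ w′ _ _)
    where
    subtract : ∀ u w u′ w′ x y →
               (u′ * x + (u′ - w′) * y) - (u * x + (u - w) * y) ≡ (u′ - u) * x + ((u′ - u) - (w′ - w)) * y
    subtract = solve-∀

  coords-+ : ∀ {k r s u w r′ s′ u′ w′} → Coords k r s u w → Coords k r′ s′ u′ w′ →
             Coords k (r + r′) (s + s′) (u + u′) (w + w′)
  coords-+ {u = u} {w} {u′ = u′} {w′} (r≡ , s≡) (r′≡ , s′≡) =
    trans (cong₂ _+_ r≡ r′≡) (add u w u′ w′ _ _) , trans (cong₂ _+_ s≡ s′≡) (add u w u′ w′ _ _)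
    where
    add : ∀ u w u′ w′ x y →
          (u * x + (u - w) * y) + (u′ * x + (u′ - w′) * y) ≡ (u + u′) * x + ((u + u′) - (w + w′)) * y
    add = solve-∀

  posForm-of-coords : ∀ {k r s u w} → Coords k r s u w → Quadrant (E k * u) (E k * w) → PosForm a r s
  posForm-of-coords {k} {r} {s} c =
    posForm-of-quadrant r s k ∘ subst₂ Quadrant (sym (proj₁ (L-of-coords c))) (sym (proj₂ (L-of-coords c)))

  posForm-if-E≡1 : ∀ {k r s u w} → E k ≡ + 1 → Coords k r s u w → Quadrant u w → PosForm a r s
  posForm-if-E≡1 {k} {u = u} {w} E≡1 c =
    posForm-of-coords c ∘ subst₂ Quadrant (sym (unit u)) (sym (unit w))
    where
    unit : ∀ t → E k * t ≡ t
    unit t = trans (cong (_* t) E≡1) (ℤₚ.*-identityˡ t)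

  negForm-if-E≡-1 : ∀ {k r s u w} → E k ≡ - + 1 → Coords k r s u w → Quadrant u w → NegForm a r s
  negForm-if-E≡-1 {k} {u = u} {w} E≡-1 c =
    posForm-of-coords (coords-neg c) ∘ subst₂ Quadrant (sym (unit u)) (sym (unit w))
    where
    unit : ∀ t → E k * - t ≡ t
    unit t = trans (cong (_* - t) E≡-1) (trans (ℤₚ.-1*i≡-i (- t)) (ℤₚ.neg-involutive t))

  -- AbsLt a q p q′ p′ is SameSign of the forms of (p′ − p, q′ − q) and (p′ + p, q′ + q).
  SameSign : ℤ → ℤ → ℤ → ℤ → Set
  SameSign r s r′ s′ = (PosForm a r s × PosForm a r′ s′) ⊎ (NegForm a r s × NegForm a r′ s′)

  sameSign-of-quadrants : ∀ {k r s u w r′ s′ u′ w′} → Coords k r s u w → Coords k r′ s′ u′ w′ →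
                          Quadrant u w → Quadrant u′ w′ → SameSign r s r′ s′
  sameSign-of-quadrants {k} c c′ h h′ with E-unit k
  ... | inj₁ E≡1  = inj₁ (posForm-if-E≡1 E≡1 c h , posForm-if-E≡1 E≡1 c′ h′)
  ... | inj₂ E≡-1 = inj₂ (negForm-if-E≡-1 E≡-1 c h , negForm-if-E≡-1 E≡-1 c′ h′)

  sameSign-neg : ∀ {r s r′ s′} → SameSign (- r) (- s) (- r′) (- s′) → SameSign r s r′ s′
  sameSign-neg (inj₁ (h , h′)) = inj₂ (h , h′)
  sameSign-neg {r} {s} {r′} {s′} (inj₂ (h , h′)) =
    inj₁ (subst₂ (PosForm a) (ℤₚ.neg-involutive r) (ℤₚ.neg-involutive s) h ,
          subst₂ (PosForm a) (ℤₚ.neg-involutive r′) (ℤₚ.neg-involutive s′) h′)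

  absLt-of-dominates : ∀ {k q p u w q′ p′ u′ w′} → Coords k (+ q) p u w → Coords k (+ q′) p′ u′ w′ →
                       Dominates u′ w′ u w → AbsLt a q p q′ p′
  absLt-of-dominates c c′ (inj₁ (d , s)) = sameSign-of-quadrants (coords-− c c′) (coords-+ c′ c) d s
  absLt-of-dominates {q = q} {p} {q′ = q′} {p′} c c′ (inj₂ (d , s)) =
    sameSign-neg {+ q′ - + q} {p′ - p} {+ q′ + + q} {p′ + p}
      (sameSign-of-quadrants (coords-neg (coords-− c c′)) (coords-neg (coords-+ c′ c)) d s)

  absLt-asym : ∀ {q p q′ p′} → AbsLt a q p q′ p′ → AbsLt a q′ p′ q p → ⊥
  absLt-asym {q} {p} {q′} {p′} (inj₁ (d , _)) (inj₁ (d′ , _)) =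
    posForm-negForm-disjoint {+ q′ - + q} {p′ - p} d
      (subst₂ (PosForm a) (swap (+ q) (+ q′)) (swap p p′) d′)
    where
    swap : ∀ x y → x - y ≡ - (y - x)
    swap = solve-∀
  absLt-asym {q} {p} {q′} {p′} (inj₁ (_ , s)) (inj₂ (_ , s′)) =
    posForm-negForm-disjoint {+ q′ + + q} {p′ + p} s
      (subst₂ (PosForm a) (cong -_ (ℤₚ.+-comm (+ q) (+ q′))) (cong -_ (ℤₚ.+-comm p p′)) s′)
  absLt-asym {q} {p} {q′} {p′} (inj₂ (_ , s)) (inj₁ (_ , s′)) =
    posForm-negForm-disjoint {+ q′ + + q} {p′ + p}
      (subst₂ (PosForm a) (ℤₚ.+-comm (+ q) (+ q′)) (ℤₚ.+-comm p p′) s′) s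
  absLt-asym {q} {p} {q′} {p′} (inj₂ (d , _)) (inj₂ (d′ , _)) =
    posForm-negForm-disjoint {+ q′ - + q} {p′ - p}
      (subst₂ (PosForm a) (unswap (+ q) (+ q′)) (unswap p p′) d′) d
    where
    unswap : ∀ x y → - (x - y) ≡ y - x
    unswap = solve-∀

module Denominators (a : ℕ.ℕ → ℕ.ℕ) (pq : PartialQuotients a) where
  open ℕ using (zero; suc; _+_; _*_; _∸_; _≤_; _<_; z≤n; s≤s)
  open import Relation.Nullary using (¬_; yes; no)
  open LinearForms a pq using (P)

  qc-step : ∀ k → qc a k ≤ qc a (suc k)
  qc-step k = ℕₚ.≤-trans (ℕₚ.m≤n*m (qc a k) (a (suc k)) {{ℕ.>-nonZero (pq k)}}) (ℕₚ.m≤m+n _ _)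

  qc-pos : ∀ k → 1 ≤ qc a k
  qc-pos zero    = s≤s z≤n
  qc-pos (suc k) = ℕₚ.≤-trans (qc-pos k) (qc-step k)

  qc-mono : ∀ {i j} → i ≤ j → qc a i ≤ qc a j
  qc-mono {j = zero} z≤n = ℕₚ.≤-refl
  qc-mono {j = suc j} i≤1+j with ℕₚ.m≤n⇒m<n∨m≡n i≤1+j
  ... | inj₁ (s≤s i≤j) = ℕₚ.≤-trans (qc-mono i≤j) (qc-step j)
  ... | inj₂ refl      = ℕₚ.≤-refl

  not-convergent-between : ∀ {p t} j → qc a j < t → t < qc a (suc j) → ¬ IsConvergent a p t
  not-convergent-between j qⱼ<t t<qⱼ₊₁ (i , _ , t≡qᵢ) with i ℕₚ.≤? j
  ... | yes i≤j = ℕₚ.<⇒≱ qⱼ<t (subst (_≤ qc a j) (sym t≡qᵢ) (qc-mono i≤j))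
  ... | no  i≰j = ℕₚ.<⇒≱ t<qⱼ₊₁ (subst (qc a (suc j) ≤_) (sym t≡qᵢ) (qc-mono (ℕₚ.≰⇒> i≰j)))

  twice-≤ : ∀ k → 2 ≤ a (suc k) → qc a k + qc a k ≤ a (suc k) * qc a k
  twice-≤ k aₖ₊₁≥2 = subst (_≤ a (suc k) * qc a k) (cong (qc a k +_) (ℕₚ.+-identityʳ (qc a k)))
                           (ℕₚ.*-monoˡ-≤ (qc a k) aₖ₊₁≥2)

  qc-rec-≥ : ∀ k → qc a (suc k) + qc a k ≤ qc a (suc (suc k))
  qc-rec-≥ k = ℕₚ.+-monoˡ-≤ (qc a k) (ℕₚ.m≤n*m (qc a (suc k)) (a (suc (suc k))) {{ℕ.>-nonZero (pq (suc k))}})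

  difference-< : ∀ k → qc a (suc k) ∸ qc a k < qc a (suc k)
  difference-< k = ℕₚ.∸-monoʳ-< (qc-pos k) (qc-step k)

  difference-not-convergent : ∀ m → 2 ≤ a (suc m) →
    ¬ IsConvergent a (P (suc m) ℤ.- P m) (qc a (suc m) ∸ qc a m)
  -- For a₁ = 2 the difference has denominator q₀, but numerator p₁ − p₀ = 1 ≠ p₀.
  difference-not-convergent zero _ (zero , p≡ , _) =
    ℕₚ.1+n≢0 (ℤₚ.+-injective (trans (cong (λ t → ℤ.+ (t + 1 + 0)) (sym (ℕₚ.*-zeroʳ (a 1)))) p≡))
  difference-not-convergent zero _ (suc i , _ , q≡) =
    ℕₚ.<⇒≱ (difference-< 0) (subst (qc a 1 ≤_) (sym q≡) (qc-mono (s≤s z≤n)))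
  difference-not-convergent (suc m) aₙ≥2 = not-convergent-between (suc m) qₙ₋₁<x (difference-< (suc m))
    where
    qₙ₋₁<x : qc a (suc m) < qc a (suc (suc m)) ∸ qc a (suc m)
    qₙ₋₁<x = ℕₚ.m+n≤o⇒m≤o∸n (suc (qc a (suc m)))
               (ℕₚ.≤-<-trans (twice-≤ (suc m) aₙ≥2) (ℕₚ.m<m+n _ (qc-pos m)))

module SmallDenominators where
  open ℕ using (ℕ; zero; suc; _+_; _*_; _≤_; _<_)
  open ℤ using (ℤ; +_; -[1+_]; -_)
  open import Data.Nat.Tactic.RingSolver using (solve-∀)
  import Data.Integer.Tactic.RingSolver as ℤ-Ring
  open Quadrants using (Far; far⁺; far⁻)
  open ≡-Reasoning

  -- Coordinates (u, w) of c_{n−1} = c_{n+1} − c_n (when a_{n+1} = 1), c_n, c_{n+1} and c_n − c_{n−1}.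
  data Candidate : ℤ → ℤ → Set where
    convₙ₋₁ : Candidate (- + 1) (- + 2)
    convₙ   : Candidate (+ 1) (+ 1)
    convₙ₊₁ : Candidate (+ 0) (- + 1)
    diffₙ   : Candidate (+ 2) (+ 3)
    far     : ∀ {u w} → Far u w → Candidate u w

  private
    absorb : ∀ {n} x c y → + n ≡ x ℤ.+ (ℤ.- + c) ℤ.* + y → + (n + c * y) ≡ x
    absorb {n} x c y eq = begin
      + (n + c * y)                               ≡⟨ ℤₚ.pos-+ n (c * y) ⟩
      + n ℤ.+ + (c * y)                           ≡⟨ cong₂ ℤ._+_ eq (ℤₚ.pos-* c y) ⟩
      (x ℤ.+ (ℤ.- + c) ℤ.* + y) ℤ.+ + c ℤ.* + y   ≡⟨ cancel x (+ c) (+ y) ⟩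
      x                                           ∎
      where
      cancel : ∀ x c y → (x ℤ.+ (ℤ.- c) ℤ.* y) ℤ.+ c ℤ.* y ≡ x
      cancel = ℤ-Ring.solve-∀

    combination⁺⁺ : ∀ {q} A X B Y → + q ≡ + A ℤ.* + X ℤ.+ + B ℤ.* + Y → q ≡ A * X + B * Y
    combination⁺⁺ A X B Y eq = ℤₚ.+-injective
      (trans eq (sym (trans (ℤₚ.pos-+ (A * X) (B * Y)) (cong₂ ℤ._+_ (ℤₚ.pos-* A X) (ℤₚ.pos-* B Y)))))

    combination⁺⁻ : ∀ {q} A X B Y → + q ≡ + A ℤ.* + X ℤ.+ -[1+ B ] ℤ.* + Y → q + suc B * Y ≡ A * X
    combination⁺⁻ A X B Y eq =
      ℤₚ.+-injective (trans (absorb (+ A ℤ.* + X) (suc B) Y eq) (sym (ℤₚ.pos-* A X)))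

    combination⁻⁺ : ∀ {q} A X B Y → + q ≡ -[1+ A ] ℤ.* + X ℤ.+ + B ℤ.* + Y → q + suc A * X ≡ B * Y
    combination⁻⁺ A X B Y eq =
      ℤₚ.+-injective (trans (absorb (+ B ℤ.* + Y) (suc A) X (trans eq (ℤₚ.+-comm (-[1+ A ] ℤ.* + X) _)))
                            (sym (ℤₚ.pos-* B Y)))

    combination⁻⁻ : ∀ {q} A X B Y → + q ≡ -[1+ A ] ℤ.* + X ℤ.+ -[1+ B ] ℤ.* + Y → q + suc B * Y + suc A * X ≡ 0
    combination⁻⁻ A X B Y eq =
      ℤₚ.+-injective (absorb (+ 0) (suc A) X (trans (absorb (-[1+ A ] ℤ.* + X) (suc B) Y eq)
                                                    (sym (ℤₚ.+-identityˡ _))))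

    too-large : ∀ {q y} k → q ≡ y + k → q < y → ⊥
    too-large k refl q<y = ℕₚ.<⇒≱ q<y (ℕₚ.m≤m+n _ k)

    too-small : ∀ X q k → X + (q + k) ≡ X → 1 ≤ q → ⊥
    too-small X q k eq 1≤q =
      ℕₚ.n>0⇒n≢0 1≤q (ℕₚ.m+n≡0⇒m≡0 q (ℕₚ.+-cancelˡ-≡ X _ _ (trans eq (sym (ℕₚ.+-identityʳ X)))))

  -- R = q_{n−1}, Q = q_n = 2 q_{n−1} + s and C = q_{n+1} = q_n + q_{n−1}.
  module _ (R s : ℕ) where

    Q C y : ℕ
    Q = 2 * R + s
    C = Q + R
    y = 2 * R + Q

    candidate : ∀ q α β → 1 ≤ q → q < y → + q ≡ α ℤ.* + Q ℤ.+ β ℤ.* + C → Candidate α (α ℤ.- β)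
    candidate q (+ zero) (+ zero) 1≤q _ eq =
      ⊥-elim (too-small 0 q 0 (trans (ℕₚ.+-identityʳ q) (combination⁺⁺ 0 Q 0 C eq)) 1≤q)
    candidate q (+ suc zero) (+ zero) _ _ _ = convₙ
    candidate q (+ suc (suc i)) (+ zero) _ q<y eq =
      ⊥-elim (too-large (s + i * Q) (trans (combination⁺⁺ (2 + i) Q 0 C eq) (expand R s i)) q<y)
      where
      expand : ∀ R s i → (2 + i) * (2 * R + s) + 0 * (2 * R + s + R) ≡
                         2 * R + (2 * R + s) + (s + i * (2 * R + s))
      expand = solve-∀
    candidate q -[1+ A ] (+ zero) 1≤q _ eq =
      ⊥-elim (too-small 0 q (suc A * Q) (combination⁻⁺ A Q 0 C eq) 1≤q)
    candidate q (+ zero) (+ suc zero) _ _ _ = convₙ₊₁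
    candidate q (+ suc i) (+ suc zero) _ q<y eq =
      ⊥-elim (too-large (R + s + i * Q) (trans (combination⁺⁺ (suc i) Q 1 C eq) (expand R s i)) q<y)
      where
      expand : ∀ R s i → suc i * (2 * R + s) + 1 * (2 * R + s + R) ≡
                         2 * R + (2 * R + s) + (R + s + i * (2 * R + s))
      expand = solve-∀
    candidate q -[1+ zero ] (+ suc zero) _ _ _ = convₙ₋₁
    candidate q -[1+ suc i ] (+ suc zero) 1≤q _ eq =
      ⊥-elim (too-small C q (R + s + i * Q)
                (trans (expand q R s i) (trans (combination⁻⁺ (suc i) Q 1 C eq) (ℕₚ.*-identityˡ C))) 1≤q)
      where
      expand : ∀ q R s i → 2 * R + s + R + (q + (R + s + i * (2 * R + s))) ≡ q + (2 + i) * (2 * R + s)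
      expand = solve-∀
    candidate q (+ A) (+ suc (suc j)) _ q<y eq =
      ⊥-elim (too-large (R + R + s + A * Q + j * C)
                (trans (combination⁺⁺ A Q (2 + j) C eq) (expand R s A j)) q<y)
      where
      expand : ∀ R s A j → A * (2 * R + s) + (2 + j) * (2 * R + s + R) ≡
                           2 * R + (2 * R + s) + (R + R + s + A * (2 * R + s) + j * (2 * R + s + R))
      expand = solve-∀
    candidate q -[1+ zero ] (+ suc (suc j)) _ q<y eq =
      ⊥-elim (too-large (j * C)
                (ℕₚ.+-cancelʳ-≡ (1 * Q) _ _ (trans (combination⁻⁺ 0 Q (2 + j) C eq) (expand R s j))) q<y)
      where
      expand : ∀ R s j → (2 + j) * (2 * R + s + R) ≡
                         2 * R + (2 * R + s) + j * (2 * R + s + R) + 1 * (2 * R + s)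
      expand = solve-∀
    candidate q -[1+ suc i ] (+ suc (suc j)) _ _ _ =
      far (subst (λ t → Far (- + (2 + i)) -[1+ suc (suc t) ]) (sym (ℕₚ.+-suc i j)) (far⁻ i (i + j)))
    candidate q (+ zero) -[1+ j ] 1≤q _ eq =
      ⊥-elim (too-small 0 q (suc j * C) (combination⁺⁻ 0 Q j C eq) 1≤q)
    candidate q (+ suc zero) -[1+ j ] 1≤q _ eq =
      ⊥-elim (too-small Q q (R + j * C)
                (trans (expand q R s j) (trans (combination⁺⁻ 1 Q j C eq) (ℕₚ.*-identityˡ Q))) 1≤q)
      where
      expand : ∀ q R s j → 2 * R + s + (q + (R + j * (2 * R + s + R))) ≡ q + suc j * (2 * R + s + R)
      expand = solve-∀
    candidate q (+ suc (suc zero)) -[1+ zero ] _ _ _ = diffₙ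
    candidate q (+ suc (suc zero)) -[1+ suc j ] _ _ _ = far (far⁺ 0 j)
    candidate q (+ suc (suc (suc i))) -[1+ j ] _ _ _ =
      far (subst (λ t → Far (+ (3 + i)) (+ suc (suc (suc t)))) (sym (ℕₚ.+-suc i j)) (far⁺ (suc i) (i + j)))
    candidate q -[1+ A ] -[1+ B ] 1≤q _ eq =
      ⊥-elim (too-small 0 q (suc B * C + suc A * Q)
                (trans (sym (ℕₚ.+-assoc q _ _)) (combination⁻⁻ A Q B C eq)) 1≤q)

module Configuration (a : ℕ.ℕ → ℕ.ℕ) (pq : PartialQuotients a) (m : ℕ.ℕ)
                     (aₙ≥2 : 2 ℕ.≤ a (ℕ.suc m)) (aₙ₊₁≡1 : a (ℕ.suc (ℕ.suc m)) ≡ 1) where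
  open ℕ using (ℕ; suc; _+_; _*_; _∸_; _≤_; _<_; z≤n; s≤s)
  open ℤ using (ℤ; +_; -[1+_]; -_)
  open import Data.Integer.Tactic.RingSolver using (solve-∀)
  open import Relation.Nullary using (¬_; yes; no)
  open Quadrants
  open LinearForms a pq
  open Denominators a pq
  open SmallDenominators using (Candidate; convₙ₋₁; convₙ; convₙ₊₁; diffₙ; far; candidate)

  n : ℕ
  n = suc m

  qₙ₋₁ qₙ s x y : ℕ
  qₙ₋₁ = qc a m
  qₙ   = qc a n
  s    = qₙ ∸ 2 * qₙ₋₁
  x    = qₙ ∸ qₙ₋₁
  y    = 2 * qₙ₋₁ + qₙ

  px py : ℤ
  px = P n ℤ.- P m
  py = + 2 ℤ.* P m ℤ.+ P n

  qₙ≡ : qₙ ≡ 2 * qₙ₋₁ + s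
  qₙ≡ = sym (ℕₚ.m+[n∸m]≡n (ℕₚ.≤-trans (ℕₚ.*-monoˡ-≤ qₙ₋₁ aₙ≥2) (ℕₚ.m≤m+n _ _)))

  qₙ₊₁≡ : qc a (suc n) ≡ qₙ + qₙ₋₁
  qₙ₊₁≡ = cong (_+ qₙ₋₁) (trans (cong (_* qₙ) aₙ₊₁≡1) (ℕₚ.*-identityˡ qₙ))

  Qₙ₊₁≡ : Q (suc n) ≡ Q n ℤ.+ Q m
  Qₙ₊₁≡ = trans (cong +_ qₙ₊₁≡) (ℤₚ.pos-+ qₙ qₙ₋₁)

  Pₙ₊₁≡ : P (suc n) ≡ P n ℤ.+ P m
  Pₙ₊₁≡ = trans (cong (λ c → + (c * pc a n + pc a m)) aₙ₊₁≡1)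
                (trans (cong (λ t → + (t + pc a m)) (ℕₚ.*-identityˡ (pc a n))) (ℤₚ.pos-+ (pc a n) (pc a m)))

  qₙ₋₁≥1 : 1 ≤ qₙ₋₁
  qₙ₋₁≥1 = qc-pos m

  2qₙ₋₁≤qₙ : qₙ₋₁ + qₙ₋₁ ≤ qₙ
  2qₙ₋₁≤qₙ = ℕₚ.≤-trans (twice-≤ m aₙ≥2) (ℕₚ.m≤m+n _ _)

  qₙ₋₁<qₙ : qₙ₋₁ < qₙ
  qₙ₋₁<qₙ = ℕₚ.<-≤-trans (ℕₚ.m<m+n qₙ₋₁ qₙ₋₁≥1) 2qₙ₋₁≤qₙ

  1≤x : 1 ≤ x
  1≤x = ℕₚ.≤-trans qₙ₋₁≥1 (ℕₚ.m+n≤o⇒m≤o∸n qₙ₋₁ 2qₙ₋₁≤qₙ)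

  x<y : x < y
  x<y = ℕₚ.≤-<-trans (ℕₚ.m∸n≤m qₙ qₙ₋₁) (ℕₚ.m<n+m qₙ (ℕₚ.≤-trans qₙ₋₁≥1 (ℕₚ.m≤m+n qₙ₋₁ _)))

  2≤y : 2 ≤ y
  2≤y = ℕₚ.≤-trans (ℕₚ.*-monoʳ-≤ 2 qₙ₋₁≥1) (ℕₚ.m≤m+n _ _)

  qₙ₊₁<y : qc a (suc n) < y
  qₙ₊₁<y = begin-strict
    qc a (suc n)  ≡⟨ trans qₙ₊₁≡ (ℕₚ.+-comm qₙ qₙ₋₁) ⟩
    qₙ₋₁ + qₙ     <⟨ ℕₚ.+-monoˡ-< qₙ (ℕₚ.m<m+n qₙ₋₁ (ℕₚ.≤-trans qₙ₋₁≥1 (ℕₚ.m≤m+n qₙ₋₁ 0))) ⟩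
    y             ∎
    where open ℕₚ.≤-Reasoning

  y<qₙ₊₂ : y < qc a (suc (suc n))
  y<qₙ₊₂ = begin-strict
    2 * qₙ₋₁ + qₙ            ≡⟨ cong (_+ qₙ) (cong (λ t → qₙ₋₁ + t) (ℕₚ.+-identityʳ qₙ₋₁)) ⟩
    qₙ₋₁ + qₙ₋₁ + qₙ         <⟨ ℕₚ.+-monoˡ-< qₙ (ℕₚ.+-monoˡ-< qₙ₋₁ qₙ₋₁<qₙ) ⟩
    qₙ + qₙ₋₁ + qₙ           ≡⟨ cong (_+ qₙ) qₙ₊₁≡ ⟨
    qc a (suc n) + qₙ        ≤⟨ qc-rec-≥ n ⟩
    qc a (suc (suc n))       ∎
    where open ℕₚ.≤-Reasoning

  x-coords : Coords n (+ x) px (+ 2) (+ 3)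
  x-coords = trans +x≡ (trans (difference (Q n) (Q m))
                              (cong (λ t → + 2 ℤ.* Q n ℤ.+ -[1+ 0 ] ℤ.* t) (sym Qₙ₊₁≡))) ,
             trans (difference (P n) (P m)) (cong (λ t → + 2 ℤ.* P n ℤ.+ -[1+ 0 ] ℤ.* t) (sym Pₙ₊₁≡))
    where
    +x≡ : + x ≡ Q n ℤ.- Q m
    +x≡ = trans (sym (ℤₚ.⊖-≥ (ℕₚ.≤-trans (ℕₚ.m≤m+n qₙ₋₁ qₙ₋₁) 2qₙ₋₁≤qₙ))) (sym (ℤₚ.m-n≡m⊖n qₙ qₙ₋₁))
    difference : ∀ u v → u ℤ.- v ≡ + 2 ℤ.* u ℤ.+ -[1+ 0 ] ℤ.* (u ℤ.+ v)
    difference = solve-∀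

  y-coords : Coords n (+ y) py (- + 1) (- + 3)
  y-coords = trans +y≡ (trans (combination (Q n) (Q m))
                              (cong (λ t → -[1+ 0 ] ℤ.* Q n ℤ.+ + 2 ℤ.* t) (sym Qₙ₊₁≡))) ,
             trans (combination (P n) (P m)) (cong (λ t → -[1+ 0 ] ℤ.* P n ℤ.+ + 2 ℤ.* t) (sym Pₙ₊₁≡))
    where
    +y≡ : + y ≡ + 2 ℤ.* Q m ℤ.+ Q n
    +y≡ = trans (ℤₚ.pos-+ (2 * qₙ₋₁) qₙ) (cong (ℤ._+ Q n) (ℤₚ.pos-* 2 qₙ₋₁))
    combination : ∀ u v → + 2 ℤ.* v ℤ.+ u ≡ -[1+ 0 ] ℤ.* u ℤ.+ + 2 ℤ.* (u ℤ.+ v)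
    combination = solve-∀

  private
    convergent : ∀ {p q} j → p ≡ P j → + q ≡ Q j → IsConvergent a p q
    convergent j p≡ q≡ = j , p≡ , ℤₚ.+-injective q≡

    at-previous : ∀ u v w → w ≡ u ℤ.+ v → -[1+ 0 ] ℤ.* u ℤ.+ + 1 ℤ.* w ≡ v
    at-previous u v w refl = simplify u v
      where
      simplify : ∀ u v → -[1+ 0 ] ℤ.* u ℤ.+ + 1 ℤ.* (u ℤ.+ v) ≡ v
      simplify = solve-∀

    at-current : ∀ u v → + 1 ℤ.* u ℤ.+ + 0 ℤ.* v ≡ u
    at-current = solve-∀

    at-next : ∀ u v → + 0 ℤ.* u ℤ.+ + 1 ℤ.* v ≡ v
    at-next = solve-∀

  candidate-of-coords : ∀ {p₂ q₂ u w} → Coords n (+ q₂) p₂ u w → 1 ≤ q₂ → q₂ < y → Candidate u w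
  candidate-of-coords {q₂ = q₂} {u} {w} c 1≤q₂ q₂<y =
    subst (Candidate u) (u-[u-w]≡w u w) (candidate qₙ₋₁ s q₂ u (u ℤ.- w) 1≤q₂ q₂<y′ q₂≡)
    where
    u-[u-w]≡w : ∀ u w → u ℤ.- (u ℤ.- w) ≡ w
    u-[u-w]≡w = solve-∀
    q₂<y′ : q₂ < 2 * qₙ₋₁ + (2 * qₙ₋₁ + s)
    q₂<y′ = subst (λ t → q₂ < 2 * qₙ₋₁ + t) qₙ≡ q₂<y
    q₂≡ : + q₂ ≡ u ℤ.* + (2 * qₙ₋₁ + s) ℤ.+ (u ℤ.- w) ℤ.* + (2 * qₙ₋₁ + s + qₙ₋₁)
    q₂≡ = trans (Coords.r≡ c) (cong₂ (λ t t′ → u ℤ.* t ℤ.+ (u ℤ.- w) ℤ.* t′) (cong +_ qₙ≡)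
                                      (cong +_ (trans qₙ₊₁≡ (cong (_+ qₙ₋₁) qₙ≡))))

  data Rival (p₂ : ℤ) (q₂ : ℕ) : Set where
    at-x : Coords n (+ q₂) p₂ (+ 2) (+ 3) → Rival p₂ q₂
    far  : ∀ {u w} → Coords n (+ q₂) p₂ u w → Far u w → Rival p₂ q₂

  rival-of-candidate : ∀ {p₂ q₂ u w} → ¬ IsConvergent a p₂ q₂ → Coords n (+ q₂) p₂ u w → Candidate u w →
                       Rival p₂ q₂
  rival-of-candidate not-convergent c convₙ₋₁ =
    ⊥-elim (not-convergent (convergent m (trans (Coords.s≡ c) (at-previous (P n) (P m) (P (suc n)) Pₙ₊₁≡))
                                         (trans (Coords.r≡ c) (at-previous (Q n) (Q m) (Q (suc n)) Qₙ₊₁≡))))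
  rival-of-candidate not-convergent c convₙ =
    ⊥-elim (not-convergent (convergent n (trans (Coords.s≡ c) (at-current (P n) (P (suc n))))
                                         (trans (Coords.r≡ c) (at-current (Q n) (Q (suc n))))))
  rival-of-candidate not-convergent c convₙ₊₁ =
    ⊥-elim (not-convergent (convergent (suc n) (trans (Coords.s≡ c) (at-next (P n) (P (suc n))))
                                               (trans (Coords.r≡ c) (at-next (Q n) (Q (suc n))))))
  rival-of-candidate _ c diffₙ   = at-x c
  rival-of-candidate _ c (far f) = far c f

  rival : ∀ {p₂ q₂} → Admissible a p₂ q₂ → q₂ < y → Rival p₂ q₂
  rival {p₂} {q₂} (1≤q₂ , not-convergent) q₂<y =
    let _ , _ , c = coords-exist n (+ q₂) p₂
    in  rival-of-candidate not-convergent c (candidate-of-coords c 1≤q₂ q₂<y)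

  x-pair-closer : ∀ {p₂ q₂} → Rival p₂ q₂ → q₂ ≢ x → AbsLt a x px q₂ p₂
  x-pair-closer (at-x c)  q₂≢x =
    ⊥-elim (q₂≢x (ℤₚ.+-injective (trans (Coords.r≡ c) (sym (Coords.r≡ x-coords)))))
  x-pair-closer (far c f) _    = absLt-of-dominates x-coords c (far-dominates-x f)

  y-pair-closer : ∀ {p₂ q₂} → Rival p₂ q₂ → AbsLt a y py q₂ p₂
  y-pair-closer (at-x c)  = absLt-of-dominates y-coords c x-dominates-y
  y-pair-closer (far c f) = absLt-of-dominates y-coords c (far-dominates-y f)

  x-admissible : Admissible a px x
  x-admissible = 1≤x , difference-not-convergent m aₙ≥2

  y-admissible : Admissible a py y
  y-admissible = ℕₚ.≤-trans (s≤s z≤n) 2≤y , not-convergent-between (suc n) qₙ₊₁<y y<qₙ₊₂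

  x-in-Q : InQ a x
  x-in-Q with x ℕₚ.≟ 1
  ... | yes x≡1 = inj₁ x≡1
  ... | no  x≢1 = inj₂ (ℕₚ.≤∧≢⇒< 1≤x (x≢1 ∘ sym) , px , x-admissible ,
                        λ _ _ adm q<x → x-pair-closer (rival adm (ℕₚ.<-trans q<x x<y)) (ℕₚ.<⇒≢ q<x))

  y-discontinuity : Discontinuity a y
  y-discontinuity = 2≤y , py , y-admissible , λ _ _ adm q<y → y-pair-closer (rival adm q<y)

  nothing-between : ∀ z → InQ a z → x < z → z < y → ⊥
  nothing-between z (inj₁ refl) x<1 _ = ℕₚ.<⇒≱ x<1 1≤x
  nothing-between z (inj₂ (_ , p , adm , beats)) x<z z<y =
    absLt-asym {z} {p} {x} {px} (beats px x x-admissible x<z)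
                                (x-pair-closer (rival adm z<y) (ℕₚ.>⇒≢ x<z))

open import Data.Nat using (ℕ; suc; _≤_; _∸_; _+_; _*_)

mainTheorem8 : (a : ℕ → ℕ) → PartialQuotients a →
    (n : ℕ) → 1 ≤ n → 2 ≤ a n → a (suc n) ≡ 1 →
    SuccessiveInQ a (qc a n ∸ qc a (n ∸ 1)) (2 * qc a (n ∸ 1) + qc a n)
mainTheorem8 a pq (suc m) _ aₙ≥2 aₙ₊₁≡1 = x<y , x-in-Q , inj₂ y-discontinuity , nothing-between
  where open Configuration a pq m aₙ≥2 aₙ₊₁≡1
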